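{- Let $k\ge 2$, $n\ge 1$, and let $u=u_0\cdots u_{kn-1}$ be a word of length $kn$ over $\Sigma_k$ in which every letter of $\Sigma_k$ occurs exactly $n$ times. The following are equivalent: (1) $u$ is an alphabet-permutation power; (2) for all $0\le j<k$ and $0\le i<n$, one has $\pi_u^{ -1}(i+jn)\in[ki,\,k(i+1)-1]$; (3) for every $0\le \ell<kn$, there is an edge from $\ell$ to $\pi_u^{ -1}(\ell)$ in the generalized de Bruijn graph $\mathrm{DB}(k,kn)$.
   Context: $\Sigma_k=\{0,1,\ldots,k-1\}$ with its natural order; words are indexed from $0$. An alphabet-permutation is a word over $\Sigma_k$ containing each letter of $\Sigma_k$ exactly once; an alphabet-permutation power is a concatenation of one or more alphabet-permutations. The standard permutation of $u=u_0\cdots u_{N-1}$ is the permutation $\pi_u$ of $\{0,\ldots,N-1\}$ with $\pi_u(i)<\pi_u(j)$ iff $u_i<u_j$, or $u_i=u_j$ and $i<j$; $\pi_u^{ -1}$ is its inverse (in one-line notation it lists the positions of $0$ in $u$ left to right, then those of $1$, etc.). The generalized de Bruijn graph $\mathrm{DB}(k,N)$ is the directed multigraph with vertex set $\{0,1,\ldots,N-1\}$ having, for every vertex $m$ and every $i\in\{0,\ldots,k-1\}$, an edge from $m$ to $km+i \bmod N$. -}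

module Defs where

open import Data.Nat using (ℕ; zero; suc; _+_; _*_; _<_; _≤_)
import Data.Nat as ℕ
open import Data.Fin using (Fin; toℕ)
import Data.Fin as F
import Data.Fin.Properties as FP
open import Data.List using (List; length; filter; find; _++_)
open import Data.List.Relation.Unary.Any using ()
open import Data.Vec using (Vec; lookup; toList)
open import Data.Maybe using (maybe)
open import Data.Product using (Σ; _×_; ∃-syntax)
open import Data.Fin using () renaming (_<?_ to _<ᶠ?_)
open import Relation.Binary.PropositionalEquality using (_≡_)
open import Relation.Nullary using (_×-dec_)
open import Data.List using () renaming (allFin to allFinL)

occ : {k : ℕ} → Fin k → List (Fin k) → ℕ
occ a w = length (filter (λ b → b FP.≟ a) w)

IsAlphabetPerm : {k : ℕ} → List (Fin k) → Set
IsAlphabetPerm {k} w = (a : Fin k) → occ a w ≡ 1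

data IsAlphabetPermPower {k : ℕ} : List (Fin k) → Set where
  single : {w : List (Fin k)} → IsAlphabetPerm w → IsAlphabetPermPower w
  cons   : {w v : List (Fin k)} → IsAlphabetPerm w → IsAlphabetPermPower v →
           IsAlphabetPermPower (w ++ v)

stdPerm : {k N : ℕ} → Vec (Fin k) N → Fin N → ℕ
stdPerm {k} {N} u i =
  length (filter (λ j → lookup u j <ᶠ? lookup u i) (allFinL N))
  + length (filter (λ j → (lookup u j FP.≟ lookup u i) ×-dec (j <ᶠ? i)) (allFinL N))

-- inverse standard permutation: π_u^{-1}(r) = the position p with π_u(p) = r
-- (the first such position; π_u is a bijection so it is unique; default 0 if none)
stdPermInv : {k N : ℕ} → Vec (Fin k) N → ℕ → ℕ
stdPermInv {k} {N} u r = maybe toℕ 0 (find (λ j → stdPerm u j ℕ.≟ r) (allFinL N))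

-- edge m → m' in the generalized de Bruijn graph DB(k,N):
-- m' is a vertex and m' = (k m + i) mod N for some i < k
DBEdge : (k N m m' : ℕ) → Set
DBEdge k N m m' = m' < N × ∃[ i ] (i < k × ∃[ q ] (k * m + i ≡ q * N + m'))

-- Call the rank of a position p the number of earlier occurrences of the letter u_p.  Since
-- every letter occurs n times, π_u(p) = rank p + u_p·n, so π_u⁻¹(i + jn) is the position of
-- the i-th occurrence of j, and (2) says that every position p lies in the block
-- [k·rank p, k·rank p + k).  A word with this block property is an alphabet-permutation power:
-- its first k letters contain every letter (a first occurrence has rank 0) and none twice
-- (a second occurrence has rank 1), and the property passes to the rest of the word.
-- Finally kℓ ≡ ki modulo kn for ℓ = i + jn, so the de Bruijn edges out of ℓ end exactly in
-- the block [ki, ki + k), which turns (3) into (2).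
module Submission where

open import Data.Bool using (true; false)
open import Data.Fin as F using (Fin; toℕ)
import Data.Fin.Properties as FP
open import Data.List as L using (List; []; _∷_; length; filter; find; take; drop; _++_)
import Data.List.Properties as LP
open import Data.List.Membership.Propositional using (lose)
open import Data.List.Membership.Propositional.Properties using (∈-allFin)
open import Data.List.Relation.Unary.All as All using ()
open import Data.List.Relation.Unary.Any as Any using (Any)
open import Data.Maybe using (just; maybe)
open import Data.Nat
  using (ℕ; zero; suc; _+_; _*_; _∸_; _/_; _%_; _≤_; _<_; s≤s; s≤s⁻¹; s<s⁻¹; z≤n; z<s; NonZero; >-nonZero⁻¹)
import Data.Nat as ℕ
open import Data.Nat.DivMod using (m≡m%n+[m/n]*n; m%n<n; m<n⇒m%n≡m; [m+kn]%n≡m%n; m<n*o⇒m/o<n)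
open import Data.Nat.Properties
open import Data.Nat.Tactic.RingSolver using (solve-∀)
open import Data.Product using (∃-syntax; _×_; _,_; proj₁; map₂)
open import Data.Product.Function.NonDependent.Propositional using (_×-⇔_)
open import Data.Sum using (_⊎_; inj₁; inj₂)
open import Data.Vec as V using (Vec; toList; lookup)
open import Defs
open import Function using (_∘_; id)
open import Function.Bundles using (_⇔_; mk⇔; Equivalence)
open import Function.Properties.Equivalence using () renaming (refl to ⇔-refl; trans to ⇔-trans)
open import Relation.Binary using (tri<; tri≈; tri>)
open import Relation.Binary.PropositionalEquality
open import Relation.Nullary using (yes; no; does; ¬_; _×-dec_; contradiction)
open import Relation.Unary using (Pred; Decidable)

open ≡-Reasoning

private variable
  A B : Set
  M : ℕ

length-filter-map : ∀ {p} {P : Pred B p} (P? : Decidable P) (f : A → B) (xs : List A) →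
  length (filter P? (L.map f xs)) ≡ length (filter (P? ∘ f) xs)
length-filter-map P? f []       = refl
length-filter-map P? f (x ∷ xs) with does (P? (f x))
... | true  = cong suc (length-filter-map P? f xs)
... | false = length-filter-map P? f xs

allFin-suc : ∀ M → L.allFin (suc M) ≡ F.zero ∷ L.map F.suc (L.allFin M)
allFin-suc M = cong (F.zero ∷_) (sym (LP.map-tabulate id F.suc))

toList≡tabulate-lookup : (u : Vec A M) → toList u ≡ L.tabulate (lookup u)
toList≡tabulate-lookup V.[]      = refl
toList≡tabulate-lookup (x V.∷ u) = cong (x ∷_) (toList≡tabulate-lookup u)

toList≡map-lookup : (u : Vec A M) → toList u ≡ L.map (lookup u) (L.allFin M)
toList≡map-lookup u = trans (toList≡tabulate-lookup u) (sym (LP.map-tabulate id (lookup u)))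

module _ {p} {P : Pred A p} (P? : Decidable P) where

  length-filter-accept : ∀ {x} xs → P x → length (filter P? (x ∷ xs)) ≡ suc (length (filter P? xs))
  length-filter-accept xs px = cong length (LP.filter-accept P? px)

  length-filter-reject : ∀ {x} xs → ¬ P x → length (filter P? (x ∷ xs)) ≡ length (filter P? xs)
  length-filter-reject xs ¬px = cong length (LP.filter-reject P? ¬px)

  length-filter-lookup : (u : Vec A M) →
    length (filter (P? ∘ lookup u) (L.allFin M)) ≡ length (filter P? (toList u))
  length-filter-lookup {M} u = begin
    length (filter (P? ∘ lookup u) (L.allFin M))       ≡⟨ length-filter-map P? (lookup u) (L.allFin M) ⟨
    length (filter P? (L.map (lookup u) (L.allFin M))) ≡⟨ cong (length ∘ filter P?) (toList≡map-lookup u) ⟨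
    length (filter P? (toList u))                      ∎

  length-filter-lookup-take : (u : Vec A M) (q : Fin M) →
    length (filter (λ j → P? (lookup u j) ×-dec (j F.<? q)) (L.allFin M)) ≡
    length (filter P? (take (toℕ q) (toList u)))
  length-filter-lookup-take {suc M} (x V.∷ u) F.zero =
    cong length (LP.filter-none (λ j → P? (lookup (x V.∷ u) j) ×-dec (j F.<? F.zero {M}))
                                (All.universal (λ _ → λ { (_ , ()) }) (L.allFin (suc M))))
  length-filter-lookup-take {suc M} (x V.∷ u) (F.suc q) = begin
    length (filter R (L.allFin (suc M)))                   ≡⟨ cong (length ∘ filter R) (allFin-suc M) ⟩
    length (filter R (F.zero ∷ L.map F.suc (L.allFin M))) ≡⟨ split-head ⟩
    length (filter P? (x ∷ take (toℕ q) (toList u)))       ∎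
    where
    R : Decidable (λ j → P (lookup (x V.∷ u) j) × j F.< F.suc q)
    R j = P? (lookup (x V.∷ u) j) ×-dec (j F.<? F.suc q)
    rest : length (filter R (L.map F.suc (L.allFin M))) ≡ length (filter P? (take (toℕ q) (toList u)))
    rest = begin
      length (filter R (L.map F.suc (L.allFin M)))
        ≡⟨ length-filter-map R F.suc (L.allFin M) ⟩
      length (filter (R ∘ F.suc) (L.allFin M))
        ≡⟨ cong length (LP.filter-≐ _ _ (map₂ s<s⁻¹ , map₂ s≤s) (L.allFin M)) ⟩
      length (filter (λ j → P? (lookup u j) ×-dec (j F.<? q)) (L.allFin M))
        ≡⟨ length-filter-lookup-take u q ⟩
      length (filter P? (take (toℕ q) (toList u)))
        ∎
    split-head : length (filter R (F.zero ∷ L.map F.suc (L.allFin M))) ≡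
                 length (filter P? (x ∷ take (toℕ q) (toList u)))
    split-head with P? x
    ... | yes _ = cong suc rest
    ... | no _  = rest

split-++ : ∀ (pre : List A) x post w v → pre ++ x ∷ post ≡ w ++ v →
  (∃[ post′ ] pre ++ x ∷ post′ ≡ w) ⊎ (∃[ pre′ ] pre ≡ w ++ pre′ × pre′ ++ x ∷ post ≡ v)
split-++ pre       x post []      v eq = inj₂ (pre , refl , eq)
split-++ []        x post (y ∷ w) v eq with refl , _ ← LP.∷-injective eq = inj₁ (w , refl)
split-++ (z ∷ pre) x post (y ∷ w) v eq with refl , eq′ ← LP.∷-injective eq
  with split-++ pre x post w v eq′
... | inj₁ (post′ , inside)       = inj₁ (post′ , cong (z ∷_) inside)
... | inj₂ (pre′ , refl , beyond) = inj₂ (pre′ , refl , beyond)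

length-before< : ∀ {pre : List A} {x post w} → pre ++ x ∷ post ≡ w → length pre < length w
length-before< {pre = pre} refl = subst (length pre <_) (sym (LP.length-++ pre)) (m<m+n (length pre) z<s)

toList-split : (u : Vec A M) (p : Fin M) →
  take (toℕ p) (toList u) ++ lookup u p ∷ drop (suc (toℕ p)) (toList u) ≡ toList u
toList-split (x V.∷ u) F.zero    = refl
toList-split (x V.∷ u) (F.suc p) = cong (x ∷_) (toList-split u p)

position-of-split : (u : Vec A M) (pre : List A) (x : A) (post : List A) → pre ++ x ∷ post ≡ toList u →
  ∃[ p ] toℕ p ≡ length pre × lookup u p ≡ x × take (toℕ p) (toList u) ≡ pre
position-of-split (y V.∷ u) []        x post refl = F.zero , refl , refl , refl
position-of-split (y V.∷ u) (z ∷ pre) x post eq with refl , eq′ ← LP.∷-injective eq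
  with p , p≡∣pre∣ , lookup≡x , take≡pre ← position-of-split u pre x post eq′
  = F.suc p , cong suc p≡∣pre∣ , lookup≡x , cong (z ∷_) take≡pre

find-just : ∀ {p} {P : Pred A p} (P? : Decidable P) {xs} → Any P xs → ∃[ y ] find P? xs ≡ just y × P y
find-just P? {x ∷ xs} any with P? x
... | yes px  = x , refl , px
... | no ¬px = find-just P? (Any.tail ¬px any)

divMod-unique : ∀ {n r s} a b → r < n → s < n → r + a * n ≡ s + b * n → r ≡ s × a ≡ b
divMod-unique {n@(suc _)} {r} {s} a b r<n s<n eq = r≡s , a≡b
  where
  r≡s : r ≡ s
  r≡s = begin
    r               ≡⟨ m<n⇒m%n≡m r<n ⟨
    r % n           ≡⟨ [m+kn]%n≡m%n r a n ⟨
    (r + a * n) % n ≡⟨ cong (_% n) eq ⟩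
    (s + b * n) % n ≡⟨ [m+kn]%n≡m%n s b n ⟩
    s % n           ≡⟨ m<n⇒m%n≡m s<n ⟩
    s               ∎
  a≡b : a ≡ b
  a≡b = *-cancelʳ-≡ a b n (+-cancelˡ-≡ r _ _ (trans eq (cong (_+ b * n) (sym r≡s))))

<⇔≤∸1 : ∀ {m n} → 0 < n → m < n ⇔ m ≤ n ∸ 1
<⇔≤∸1 {n = suc _} _ = mk⇔ s≤s⁻¹ s≤s

m*[n+o*p]+q≡m*n+q+o*[m*p] : ∀ m n o p q → m * (n + o * p) + q ≡ (m * n + q) + o * (m * p)
m*[n+o*p]+q≡m*n+q+o*[m*p] = solve-∀

m+n*o<p*o : ∀ {m n o p} → m < o → n < p → m + n * o < p * o
m+n*o<p*o {n = n} {o} m<o n<p = <-≤-trans (+-monoˡ-< (n * o) m<o) (*-monoˡ-≤ o n<p)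

InBlock : ℕ → ℕ → ℕ → Set
InBlock k i q = k * i ≤ q × q < k * suc i

InBlock⇔bounds : ∀ k {i q} → .{{NonZero k}} → InBlock k i q ⇔ (k * i ≤ q × q ≤ k * (i + 1) ∸ 1)
InBlock⇔bounds k {i} rewrite +-comm i 1 = ⇔-refl ×-⇔ <⇔≤∸1 (>-nonZero⁻¹ (k * suc i) {{m*n≢0 k (suc i)}})

DBEdge⇔InBlock : ∀ k {n i j q} → i < n → DBEdge k (k * n) (i + j * n) q ⇔ InBlock k i q
DBEdge⇔InBlock k {n} {i} {j} {q} i<n = mk⇔ to from
  where
  k*[1+i]≡k*i+k : k * suc i ≡ k * i + k
  k*[1+i]≡k*i+k = trans (*-suc k i) (+-comm k (k * i))
  to : DBEdge k (k * n) (i + j * n) q → InBlock k i q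
  to (q<kn , d , d<k , c , eq) = subst (InBlock k i) start≡q (m≤m+n (k * i) d , start<next)
    where
    start<next : k * i + d < k * suc i
    start<next = subst (k * i + d <_) (sym k*[1+i]≡k*i+k) (+-monoʳ-< (k * i) d<k)
    start≡q : k * i + d ≡ q
    start≡q = proj₁ (divMod-unique j c (≤-trans start<next (*-monoʳ-≤ k i<n)) q<kn
      (trans (sym (m*[n+o*p]+q≡m*n+q+o*[m*p] k i j n d)) (trans eq (+-comm (c * (k * n)) q))))
  from : InBlock k i q → DBEdge k (k * n) (i + j * n) q
  from (lo , hi) = ≤-trans hi (*-monoʳ-≤ k i<n) , q ∸ k * i , offset<k , j , eq
    where
    offset<k : q ∸ k * i < k
    offset<k = +-cancelˡ-< (k * i) (q ∸ k * i) k (subst₂ _<_ (sym (m+[n∸m]≡n lo)) k*[1+i]≡k*i+k hi)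
    eq : k * (i + j * n) + (q ∸ k * i) ≡ j * (k * n) + q
    eq = begin
      k * (i + j * n) + (q ∸ k * i)       ≡⟨ m*[n+o*p]+q≡m*n+q+o*[m*p] k i j n (q ∸ k * i) ⟩
      (k * i + (q ∸ k * i)) + j * (k * n) ≡⟨ cong (_+ j * (k * n)) (m+[n∸m]≡n lo) ⟩
      q + j * (k * n)                     ≡⟨ +-comm q (j * (k * n)) ⟩
      j * (k * n) + q                     ∎

module _ {k : ℕ} where

  occ-∷-≡ : ∀ {x a : Fin k} w → x ≡ a → occ a (x ∷ w) ≡ suc (occ a w)
  occ-∷-≡ w x≡a = length-filter-accept (λ b → b FP.≟ _) w x≡a

  occ-∷-≢ : ∀ {x a : Fin k} w → x ≢ a → occ a (x ∷ w) ≡ occ a w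
  occ-∷-≢ w x≢a = length-filter-reject (λ b → b FP.≟ _) w x≢a

  occ-∷-cancel : ∀ (x : Fin k) {a} v w → occ a (x ∷ v) ≡ occ a (x ∷ w) → occ a v ≡ occ a w
  occ-∷-cancel x {a} v w eq with x FP.≟ a
  ... | yes _ = suc-injective eq
  ... | no _  = eq

  occ-++ : ∀ (a : Fin k) v w → occ a (v ++ w) ≡ occ a v + occ a w
  occ-++ a v w = trans (cong length (LP.filter-++ (λ b → b FP.≟ a) v w)) (LP.length-++ (filter (λ b → b FP.≟ a) v))

  occ-before< : ∀ {pre post w} {a : Fin k} → pre ++ a ∷ post ≡ w → occ a pre < occ a w
  occ-before< {pre} {post} {a = a} refl = subst (occ a pre <_) (sym occ≡) (m<m+n (occ a pre) z<s)
    where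
    occ≡ : occ a (pre ++ a ∷ post) ≡ occ a pre + suc (occ a post)
    occ≡ = trans (occ-++ a pre (a ∷ post)) (cong (occ a pre +_) (occ-∷-≡ post refl))

  split-at-occurrence : ∀ (a : Fin k) w i → i < occ a w →
    ∃[ pre ] ∃[ post ] pre ++ a ∷ post ≡ w × occ a pre ≡ i
  split-at-occurrence a (x ∷ w) i i<occ with x FP.≟ a
  split-at-occurrence a (x ∷ w) zero    _           | yes refl = [] , w , refl , refl
  split-at-occurrence a (x ∷ w) (suc i) (s≤s i<occ) | yes refl
    with pre , post , split , occ≡i ← split-at-occurrence a w i i<occ
    = x ∷ pre , post , cong (x ∷_) split , trans (occ-∷-≡ pre refl) (cong suc occ≡i)
  ... | no x≢a
    with pre , post , split , occ≡i ← split-at-occurrence a w i i<occ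
    = x ∷ pre , post , cong (x ∷_) split , trans (occ-∷-≢ pre x≢a) occ≡i

  below? : (m : ℕ) → Decidable (λ (x : Fin k) → toℕ x < m)
  below? m x = toℕ x ℕ.<? m

  count-below-suc : ∀ {m} (m<k : m < k) w →
    length (filter (below? (suc m)) w) ≡ length (filter (below? m) w) + occ (F.fromℕ< m<k) w
  count-below-suc m<k [] = refl
  count-below-suc {m} m<k (x ∷ w) with <-cmp (toℕ x) m
  ... | tri< x<m x≢m _ = begin
    length (filter (below? (suc m)) (x ∷ w))
      ≡⟨ length-filter-accept (below? (suc m)) w (m<n⇒m<1+n x<m) ⟩
    suc (length (filter (below? (suc m)) w))
      ≡⟨ cong suc (count-below-suc m<k w) ⟩
    suc (length (filter (below? m) w)) + occ (F.fromℕ< m<k) w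
      ≡⟨ cong₂ _+_ (length-filter-accept (below? m) w x<m)
                   (occ-∷-≢ {x} w (x≢m ∘ λ { refl → FP.toℕ-fromℕ< m<k })) ⟨
    length (filter (below? m) (x ∷ w)) + occ (F.fromℕ< m<k) (x ∷ w)
      ∎
  ... | tri≈ x≮m x≡m _ = begin
    length (filter (below? (suc m)) (x ∷ w))
      ≡⟨ length-filter-accept (below? (suc m)) w (s≤s (≤-reflexive x≡m)) ⟩
    suc (length (filter (below? (suc m)) w))
      ≡⟨ cong suc (count-below-suc m<k w) ⟩
    suc (length (filter (below? m) w) + occ (F.fromℕ< m<k) w)
      ≡⟨ +-suc _ _ ⟨
    length (filter (below? m) w) + suc (occ (F.fromℕ< m<k) w)
      ≡⟨ cong₂ _+_ (length-filter-reject (below? m) w x≮m)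
                   (occ-∷-≡ w (FP.toℕ-injective (trans x≡m (sym (FP.toℕ-fromℕ< m<k))))) ⟨
    length (filter (below? m) (x ∷ w)) + occ (F.fromℕ< m<k) (x ∷ w)
      ∎
  ... | tri> x≮m x≢m m<x = begin
    length (filter (below? (suc m)) (x ∷ w))
      ≡⟨ length-filter-reject (below? (suc m)) w (<⇒≱ m<x ∘ s≤s⁻¹) ⟩
    length (filter (below? (suc m)) w)
      ≡⟨ count-below-suc m<k w ⟩
    length (filter (below? m) w) + occ (F.fromℕ< m<k) w
      ≡⟨ cong₂ _+_ (length-filter-reject (below? m) w x≮m)
                   (occ-∷-≢ {x} w (x≢m ∘ λ { refl → FP.toℕ-fromℕ< m<k })) ⟨
    length (filter (below? m) (x ∷ w)) + occ (F.fromℕ< m<k) (x ∷ w)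
      ∎

  count-below : ∀ {n} w → (∀ a → occ a w ≡ n) → ∀ m → m ≤ k → length (filter (below? m) w) ≡ m * n
  count-below w occ≡n zero    _   = cong length (LP.filter-none (below? 0) (All.universal (λ _ → λ ()) w))
  count-below {n} w occ≡n (suc m) m<k = begin
    length (filter (below? (suc m)) w)                  ≡⟨ count-below-suc m<k w ⟩
    length (filter (below? m) w) + occ (F.fromℕ< m<k) w
      ≡⟨ cong₂ _+_ (count-below w occ≡n m (<⇒≤ m<k)) (occ≡n _) ⟩
    m * n + n                                           ≡⟨ +-comm (m * n) n ⟩
    suc m * n                                           ∎

  length≡k*n : ∀ {n} w → (∀ a → occ a w ≡ n) → length w ≡ k * n
  length≡k*n {n} w occ≡n = begin
    length w                     ≡⟨ cong length (LP.filter-all (below? k) (All.universal FP.toℕ<n w)) ⟨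
    length (filter (below? k) w) ≡⟨ count-below w occ≡n k ≤-refl ⟩
    k * n                        ∎

  length-alphabetPerm : ∀ w → IsAlphabetPerm w → length w ≡ k
  length-alphabetPerm w perm = trans (length≡k*n w perm) (*-identityʳ k)

  occ-alphabetPerm-++ : ∀ b w {a : Fin k} → IsAlphabetPerm b → occ a (b ++ w) ≡ suc (occ a w)
  occ-alphabetPerm-++ b w {a} perm = trans (occ-++ a b w) (cong (_+ occ a w) (perm a))

  length-alphabetPerm-++ : ∀ (b : List (Fin k)) w → IsAlphabetPerm b → length (b ++ w) ≡ k + length w
  length-alphabetPerm-++ b w perm = trans (LP.length-++ b) (cong (_+ length w) (length-alphabetPerm b perm))

  InBlock-zero : ∀ {q} → q < k → InBlock k 0 q
  InBlock-zero {q} q<k = subst (_≤ q) (sym (*-zeroʳ k)) z≤n , subst (q <_) (sym (*-identityʳ k)) q<k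

  InBlock-zero⁻ : ∀ {q} → InBlock k 0 q → q < k
  InBlock-zero⁻ {q} (_ , q<k) = subst (q <_) (*-identityʳ k) q<k

  InBlock-one⁻ : ∀ {q} → InBlock k 1 q → k ≤ q
  InBlock-one⁻ {q} (k≤q , _) = subst (_≤ q) (*-identityʳ k) k≤q

  InBlock-suc : ∀ {i q} → InBlock k i q → InBlock k (suc i) (k + q)
  InBlock-suc {i} {q} (lo , hi) =
    subst (_≤ k + q) (sym (*-suc k i)) (+-monoʳ-≤ k lo) ,
    subst (k + q <_) (sym (*-suc k (suc i))) (+-monoʳ-< k hi)

  InBlock-suc⁻ : ∀ {i q} → InBlock k (suc i) (k + q) → InBlock k i q
  InBlock-suc⁻ {i} {q} (lo , hi) =
    +-cancelˡ-≤ k (k * i) q (subst (_≤ k + q) (*-suc k i) lo) ,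
    +-cancelˡ-< k q (k * suc i) (subst (k + q <_) (*-suc k (suc i)) hi)

  -- A position of w is a decomposition w = pre ++ x ∷ post; its rank is occ x pre.
  InBlocks : List (Fin k) → Set
  InBlocks w = ∀ pre x post → pre ++ x ∷ post ≡ w → InBlock k (occ x pre) (length pre)

  InBlocks-alphabetPerm : ∀ {w} → IsAlphabetPerm w → InBlocks w
  InBlocks-alphabetPerm {w} perm pre x post eq =
    subst (λ i → InBlock k i (length pre)) (sym occ≡0) (InBlock-zero pre<k)
    where
    occ≡0 : occ x pre ≡ 0
    occ≡0 = n<1⇒n≡0 (subst (occ x pre <_) (perm x) (occ-before< eq))
    pre<k : length pre < k
    pre<k = subst (length pre <_) (length-alphabetPerm w perm) (length-before< eq)

  InBlocks-++ : ∀ {b v} → IsAlphabetPerm b → InBlocks v → InBlocks (b ++ v)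
  InBlocks-++ {b} {v} perm blocks pre x post eq with split-++ pre x post b v eq
  ... | inj₁ (post′ , inside)       = InBlocks-alphabetPerm perm pre x post′ inside
  ... | inj₂ (pre′ , refl , beyond) =
    subst₂ (InBlock k) (sym (occ-alphabetPerm-++ b pre′ perm)) (sym (length-alphabetPerm-++ b pre′ perm))
      (InBlock-suc (blocks pre′ x post beyond))

  InBlocks-++⁻ : ∀ {b v} → IsAlphabetPerm b → InBlocks (b ++ v) → InBlocks v
  InBlocks-++⁻ {b} perm blocks pre x post refl = InBlock-suc⁻
    (subst₂ (InBlock k) (occ-alphabetPerm-++ b pre perm) (length-alphabetPerm-++ b pre perm)
      (blocks (b ++ pre) x post (LP.++-assoc b pre (x ∷ post))))

  InBlocks-alphabetPermPower : ∀ {w} → IsAlphabetPermPower w → InBlocks w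
  InBlocks-alphabetPermPower (single perm)     = InBlocks-alphabetPerm perm
  InBlocks-alphabetPermPower (cons perm power) = InBlocks-++ perm (InBlocks-alphabetPermPower power)

  alphabetPerm-take : ∀ {m} w → InBlocks w → (∀ a → occ a w ≡ suc m) → IsAlphabetPerm (take k w)
  alphabetPerm-take {m} w blocks occ≡ a = ≤-antisym at-most-once at-least-once
    where
    b v : List (Fin k)
    b = take k w
    v = drop k w
    b++v≡w : b ++ v ≡ w
    b++v≡w = LP.take++drop≡id k w
    ∣b∣≡k : length b ≡ k
    ∣b∣≡k = trans (LP.length-take k w)
                  (m≤n⇒m⊓n≡m (subst (k ≤_) (sym (length≡k*n w occ≡)) (m≤m*n k (suc m))))
    at-most-once : occ a b ≤ 1
    at-most-once = ≮⇒≥ λ 1<occ →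
      let pre , post , split , occ≡1 = split-at-occurrence a b 1 1<occ
          in-w = trans (sym (LP.++-assoc pre (a ∷ post) v)) (trans (cong (_++ v) split) b++v≡w)
      in <⇒≱ (subst (length pre <_) ∣b∣≡k (length-before< split))
             (InBlock-one⁻ (subst (λ i → InBlock k i (length pre)) occ≡1 (blocks pre a (post ++ v) in-w)))
    at-least-once : 1 ≤ occ a b
    at-least-once with pre , post , split , occ≡0 ← split-at-occurrence a w 0 (subst (0 <_) (sym (occ≡ a)) z<s)
      with split-++ pre a post b v (trans split (sym b++v≡w))
    ... | inj₁ (_ , inside)      = ≤-<-trans z≤n (occ-before< inside)
    ... | inj₂ (pre′ , refl , _) = contradiction
      (InBlock-zero⁻ (subst (λ i → InBlock k i (length (b ++ pre′))) occ≡0 (blocks (b ++ pre′) a post split)))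
      (≤⇒≯ (subst (_≤ length (b ++ pre′)) ∣b∣≡k (LP.length-++-≤ˡ b)))

  alphabetPermPower-InBlocks : ∀ m w → InBlocks w → (∀ a → occ a w ≡ suc m) → IsAlphabetPermPower w
  alphabetPermPower-InBlocks zero w blocks occ≡ =
    subst IsAlphabetPermPower (LP.take-all k w (≤-reflexive ∣w∣≡k)) (single (alphabetPerm-take w blocks occ≡))
    where
    ∣w∣≡k : length w ≡ k
    ∣w∣≡k = trans (length≡k*n w occ≡) (*-identityʳ k)
  alphabetPermPower-InBlocks (suc m) w blocks occ≡ =
    subst IsAlphabetPermPower b++v≡w (cons perm (alphabetPermPower-InBlocks m v blocks-v occ-v))
    where
    b v : List (Fin k)
    b = take k w
    v = drop k w
    b++v≡w : b ++ v ≡ w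
    b++v≡w = LP.take++drop≡id k w
    perm : IsAlphabetPerm b
    perm = alphabetPerm-take w blocks occ≡
    blocks-v : InBlocks v
    blocks-v = InBlocks-++⁻ perm (subst InBlocks (sym b++v≡w) blocks)
    occ-v : ∀ a → occ a v ≡ suc m
    occ-v a = suc-injective (trans (sym (occ-alphabetPerm-++ b v perm)) (trans (cong (occ a) b++v≡w) (occ≡ a)))

  alphabetPermPower⇔InBlocks : ∀ {m w} → (∀ a → occ a w ≡ suc m) → IsAlphabetPermPower w ⇔ InBlocks w
  alphabetPermPower⇔InBlocks {m} {w} occ≡ =
    mk⇔ InBlocks-alphabetPermPower (λ blocks → alphabetPermPower-InBlocks m w blocks occ≡)

  rank : Vec (Fin k) M → Fin M → ℕ
  rank u p = occ (lookup u p) (take (toℕ p) (toList u))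

  rank-injective : (u : Vec (Fin k) M) {p q : Fin M} → lookup u p ≡ lookup u q → rank u p ≡ rank u q → p ≡ q
  rank-injective (x V.∷ u) {F.zero}  {F.zero}  _   _  = refl
  rank-injective (x V.∷ u) {F.zero}  {F.suc q} x≡  r≡ =
    contradiction (trans r≡ (occ-∷-≡ _ x≡)) 0≢1+n
  rank-injective (x V.∷ u) {F.suc p} {F.zero}  ≡x  r≡ =
    contradiction (trans (sym r≡) (occ-∷-≡ _ (sym ≡x))) 0≢1+n
  rank-injective (x V.∷ u) {F.suc p} {F.suc q} a≡b r≡ = cong F.suc (rank-injective u a≡b ranks≡)
    where
    before-p before-q : List (Fin k)
    before-p = take (toℕ p) (toList u)
    before-q = take (toℕ q) (toList u)
    ranks≡ : rank u p ≡ rank u q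
    ranks≡ = begin
      occ (lookup u p) before-p ≡⟨ occ-∷-cancel x _ _ (trans r≡ (cong (λ c → occ c (x ∷ before-q)) (sym a≡b))) ⟩
      occ (lookup u p) before-q ≡⟨ cong (λ c → occ c before-q) a≡b ⟩
      occ (lookup u q) before-q ∎

module _ {k n M : ℕ} (u : Vec (Fin k) M) (occ≡n : ∀ a → occ a (toList u) ≡ n) where

  rank<n : ∀ p → rank u p < n
  rank<n p = subst (rank u p <_) (occ≡n (lookup u p)) (occ-before< (toList-split u p))

  stdPerm≡rank+letter*n : ∀ p → stdPerm u p ≡ rank u p + toℕ (lookup u p) * n
  stdPerm≡rank+letter*n p = begin
    stdPerm u p          ≡⟨ cong₂ _+_ smaller-letters (length-filter-lookup-take (λ b → b FP.≟ a) u p) ⟩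
    toℕ a * n + rank u p ≡⟨ +-comm (toℕ a * n) (rank u p) ⟩
    rank u p + toℕ a * n ∎
    where
    a : Fin k
    a = lookup u p
    smaller-letters : length (filter (λ j → lookup u j F.<? a) (L.allFin M)) ≡ toℕ a * n
    smaller-letters = trans (length-filter-lookup (below? (toℕ a)) u)
                            (count-below (toList u) occ≡n (toℕ a) (<⇒≤ (FP.toℕ<n a)))

  stdPerm-injective : ∀ {p q} → stdPerm u p ≡ stdPerm u q → p ≡ q
  stdPerm-injective {p} {q} eq
    with rank≡ , letter≡ ← divMod-unique _ _ (rank<n p) (rank<n q)
           (trans (sym (stdPerm≡rank+letter*n p)) (trans eq (stdPerm≡rank+letter*n q)))
    = rank-injective u (FP.toℕ-injective letter≡) rank≡

  stdPermInv-stdPerm : ∀ p → stdPermInv u (stdPerm u p) ≡ toℕ p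
  stdPermInv-stdPerm p
    with y , found , eq ← find-just (λ j → stdPerm u j ℕ.≟ stdPerm u p) (lose (∈-allFin p) refl)
    = trans (cong (maybe toℕ 0) found) (cong toℕ (stdPerm-injective eq))

  stdPermInv-split : ∀ pre a post → pre ++ a ∷ post ≡ toList u →
    stdPermInv u (occ a pre + toℕ a * n) ≡ length pre
  stdPermInv-split pre a post eq with p , p≡∣pre∣ , refl , refl ← position-of-split u pre a post eq
    = trans (cong (stdPermInv u) (sym (stdPerm≡rank+letter*n p))) (trans (stdPermInv-stdPerm p) p≡∣pre∣)

  InBlocks⇔stdPermInv-InBlock :
    InBlocks (toList u) ⇔ (∀ j i → j < k → i < n → InBlock k i (stdPermInv u (i + j * n)))
  InBlocks⇔stdPermInv-InBlock = mk⇔ to from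
    where
    to : InBlocks (toList u) → ∀ j i → j < k → i < n → InBlock k i (stdPermInv u (i + j * n))
    to blocks j i j<k i<n
      with pre , post , eq , occ≡i ←
             split-at-occurrence (F.fromℕ< j<k) (toList u) i (subst (i <_) (sym (occ≡n _)) i<n)
      = subst₂ (InBlock k) occ≡i ∣pre∣≡ (blocks pre a post eq)
      where
      a : Fin k
      a = F.fromℕ< j<k
      ∣pre∣≡ : length pre ≡ stdPermInv u (i + j * n)
      ∣pre∣≡ = begin
        length pre
          ≡⟨ stdPermInv-split pre a post eq ⟨
        stdPermInv u (occ a pre + toℕ a * n)
          ≡⟨ cong₂ (λ i j → stdPermInv u (i + j * n)) occ≡i (FP.toℕ-fromℕ< j<k) ⟩
        stdPermInv u (i + j * n)
          ∎
    from : (∀ j i → j < k → i < n → InBlock k i (stdPermInv u (i + j * n))) → InBlocks (toList u)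
    from inBlock pre x post eq = subst (InBlock k (occ x pre)) (stdPermInv-split pre x post eq)
      (inBlock (toℕ x) (occ x pre) (FP.toℕ<n x) (subst (occ x pre <_) (occ≡n x) (occ-before< eq)))

lemma8 : (k n : ℕ) → 2 ≤ k → 1 ≤ n → (u : Vec (Fin k) (k * n)) →
    ((a : Fin k) → occ a (toList u) ≡ n) →
    (IsAlphabetPermPower (toList u) ⇔
      ((j i : ℕ) → j < k → i < n →
        (k * i ≤ stdPermInv u (i + j * n)) × (stdPermInv u (i + j * n) ≤ k * (i + 1) ∸ 1)))
    × (IsAlphabetPermPower (toList u) ⇔
      ((ℓ : ℕ) → ℓ < k * n → DBEdge k (k * n) ℓ (stdPermInv u ℓ)))
-- The hypotheses 2 ≤ k and 1 ≤ n serve only to exclude k = 0 and n = 0.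
lemma8 k@(suc _) n@(suc _) _ _ u occ≡n =
    ⇔-trans power⇔blocks (mk⇔ (λ blocks j i j<k i<n → Equivalence.to (InBlock⇔bounds k) (blocks j i j<k i<n))
                              (λ bounds j i j<k i<n → Equivalence.from (InBlock⇔bounds k) (bounds j i j<k i<n)))
  , ⇔-trans power⇔blocks (mk⇔ blocks⇒edges edges⇒blocks)
  where
  Blocks : Set
  Blocks = ∀ j i → j < k → i < n → InBlock k i (stdPermInv u (i + j * n))
  power⇔blocks : IsAlphabetPermPower (toList u) ⇔ Blocks
  power⇔blocks = ⇔-trans (alphabetPermPower⇔InBlocks occ≡n) (InBlocks⇔stdPermInv-InBlock u occ≡n)
  blocks⇒edges : Blocks → ∀ ℓ → ℓ < k * n → DBEdge k (k * n) ℓ (stdPermInv u ℓ)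
  blocks⇒edges blocks ℓ ℓ<kn =
    subst (λ ℓ → DBEdge k (k * n) ℓ (stdPermInv u ℓ)) (sym (m≡m%n+[m/n]*n ℓ n))
    (Equivalence.from (DBEdge⇔InBlock k {j = ℓ / n} (m%n<n ℓ n))
                      (blocks (ℓ / n) (ℓ % n) (m<n*o⇒m/o<n ℓ<kn) (m%n<n ℓ n)))
  edges⇒blocks : (∀ ℓ → ℓ < k * n → DBEdge k (k * n) ℓ (stdPermInv u ℓ)) → Blocks
  edges⇒blocks edges j i j<k i<n =
    Equivalence.to (DBEdge⇔InBlock k {j = j} i<n) (edges (i + j * n) (m+n*o<p*o i<n j<k))
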